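{- Let $n \ge 1$ and $t \ge 1$ be integers, and let $\alpha, \beta, \theta \in \mathbb{F}_{3^n}^*$. Define $f: \mathbb{F}_{3^n} \to \mathbb{F}_{3^n}$ by $$f(x) = \begin{cases} 0 & \text{if } x = 0, \\ \alpha x^t & \text{if } x \in C_0, \\ \beta(x^3 + \theta x^2 + \theta^2 x) & \text{if } x \in C_1. \end{cases}$$ Suppose $f$ is a permutation of $\mathbb{F}_{3^n}$ and $\eta(\alpha) = (-1)^m$ with $m \in \{0,1\}$. Then the inverse of $f$ on $\mathbb{F}_{3^n}$ is $$f^{ -1}(x) = -u(x)\left(1 + (-1)^m x^{(3^n-1)/2}\right) - v(x)\left(1 + (-1)^{m+1} x^{(3^n-1)/2}\right),$$ where: - $u(x) = (\alpha^{ -1} x)^s$, with $s$ the inverse of $t$ modulo $(3^n-1)/2$; - $v(x) = \sum_{0 \le j,k \le n-1} \theta \left(\beta^{ -1}\theta^{ -3} x\right)^{\frac{3^j+3^k}{2}}$.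
   Context: $C_0 = \{e^2 : e \in \mathbb{F}_{3^n}^*\}$ and $C_1 = \mathbb{F}_{3^n}^* \setminus C_0$. $\eta$ is the quadratic character of $\mathbb{F}_{3^n}$: $\eta(a) = 1$ on $C_0$ and $-1$ on $C_1$. The inverse of $f$ is a polynomial $g$ with $g(f(c)) = c$ for all $c \in \mathbb{F}_{3^n}$. It is known that such $f$ is a permutation if and only if $\gcd(t, \frac{3^n-1}{2}) = 1$, $\eta(\theta) = 1$ and $\eta(\alpha) = \eta(\beta)$; in particular $s$ exists. -}

module Defs where

open import Level using (0ℓ)
open import Data.Nat as ℕ using (ℕ; zero; suc; _∸_; _/_)
open import Data.Fin using (Fin)
open import Data.List using (List; foldr; map; concatMap; upTo)
open import Data.Product using (Σ; ∃; _×_; _,_)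
open import Relation.Binary.PropositionalEquality using (_≡_; _≢_)
open import Relation.Nullary using (¬_)
open import Algebra.Structures using (IsCommutativeRing)
open import Function.Bundles using (_↔_)

-- A finite field with exactly 3^n elements (equality is propositional).
-- Any such structure is (isomorphic to) F_{3^n}.
record GF3 (n : ℕ) : Set₁ where
  infixl 7 _*_
  infixl 6 _+_ _-_
  field
    Carrier : Set
    _+_ _*_ : Carrier → Carrier → Carrier
    -_      : Carrier → Carrier
    0# 1#   : Carrier
    isCommutativeRing : IsCommutativeRing _≡_ _+_ _*_ -_ 0# 1#
    0≢1     : 0# ≢ 1#
    _⁻¹     : Carrier → Carrier
    inverseʳ : ∀ x → x ≢ 0# → x * (x ⁻¹) ≡ 1#
    card    : Carrier ↔ Fin (3 ℕ.^ n)

  _-_ : Carrier → Carrier → Carrier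
  x - y = x + (- y)

  _^_ : Carrier → ℕ → Carrier
  x ^ zero  = 1#
  x ^ suc k = x * (x ^ k)
  infixr 8 _^_

  C₀ : Carrier → Set
  C₀ a = ∃ λ e → e ≢ 0# × e * e ≡ a

  C₁ : Carrier → Set
  C₁ a = a ≢ 0# × ¬ C₀ a

  η≡[-1]^ : Carrier → ℕ → Set
  η≡[-1]^ a m = (m ≡ 0 × C₀ a) Data.Sum.⊎ (m ≡ 1 × C₁ a)
    where import Data.Sum

  sgn : ℕ → Carrier
  sgn m = (- 1#) ^ m

  N : ℕ
  N = (3 ℕ.^ n ∸ 1) / 2

  sumF : List Carrier → Carrier
  sumF = foldr _+_ 0#

  u : Carrier → ℕ → Carrier → Carrier
  u α s x = ((α ⁻¹) * x) ^ s

  v : Carrier → Carrier → Carrier → Carrier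
  v β θ x = sumF (concatMap (λ j → map (λ k →
              θ * ((β ⁻¹) * ((θ ^ 3) ⁻¹) * x) ^ ((3 ℕ.^ j ℕ.+ 3 ℕ.^ k) / 2))
              (upTo n)) (upTo n))

  finv : Carrier → Carrier → Carrier → ℕ → ℕ → Carrier → Carrier
  finv α β θ s m x =
    - (u α s x * (1# + sgn m * x ^ N)) - v β θ x * (1# + sgn (suc m) * x ^ N)

{-# OPTIONS --safe #-}

-- The field has characteristic 3: translation by 1 permutes it, so it fixes the sum of all its
-- elements, which forces 3^n · 1 = 0. Pairing each nonzero x with c / x (Wilson) gives Euler's
-- criterion: y ^ N is 1 on squares and -1 on non-squares, N = (3^n - 1) / 2. Hence f maps C₀ to
-- {y ^ N = η(α)} and C₁ to {y ^ N = -η(β)}, and η(β) = η(α) because f is onto; the factors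
-- 1 ± (-1)^m x^N select the branch. On C₀, u inverts α x^t since s t ≡ 1 mod N. On C₁, θ must be a
-- square (else f θ = 0 = f 0) and f x = β x (x - θ)²; with z = x / θ and W = z (z - 1)², the
-- exponents (3^j + 3^k) / 2 split v into θ W (Σⱼ W^((3^j - 1)/2))², and the Frobenius
-- (z - 1)^(3^j) = z^(3^j) - 1 telescopes (z - 1) Σⱼ W^((3^j - 1)/2) to z^N - 1 = 1, so
-- v (f x) = θ z = x.
module Submission where

open import Defs
open import Data.Nat as ℕ using (ℕ; zero; suc; _≥_; _∸_)
open import Data.Product using (∃; _×_; _,_; proj₁; proj₂)
open import Relation.Binary.PropositionalEquality
import Relation.Binary.PropositionalEquality as ≡
open import Function.Definitions using (Bijective)

open import Algebra.Bundles using (CommutativeMonoid; CommutativeRing; RawRing)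
open import Algebra.Core using (Op₂)
open import Algebra.Structures using (IsCommutativeMonoid)
open import Algebra.Solver.Ring.AlmostCommutativeRing
  using (fromCommutativeRing; _-Raw-AlmostCommutative⟶_)
open import Data.Fin.Properties using (inj⇒≟)
open import Data.List using (List; []; _∷_; _++_; foldr; length; map; tabulate; concatMap; upTo; applyUpTo)
open import Data.List.Membership.Propositional using (_∈_; _∉_; lose)
open import Data.List.Membership.Propositional.Properties using (∈-∃++; ∈-map⁺; ∈-tabulate⁺)
open import Data.List.Properties using (length-tabulate; map-cong; concatMap-cong; map-applyUpTo)
open import Data.List.Membership.Propositional.Properties.WithK using (unique∧set⇒bag)
open import Data.List.Relation.Binary.BagAndSetEquality using (∼bag⇒↭)
open import Data.List.Relation.Binary.Permutation.Propositional using (_↭_; ↭-refl; ↭-sym; ↭-trans; ↭⇒↭ₛ; prep)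
open import Data.List.Relation.Binary.Permutation.Propositional.Properties
  using (shift; ∈-resp-↭; ↭-length)
import Data.List.Relation.Binary.Permutation.Setoid.Properties as ↭ₛ
open import Data.List.Relation.Unary.Any using (here; there; any?; satisfied)
import Data.List.Relation.Unary.AllPairs as AllPairs
open import Data.List.Relation.Unary.Unique.Propositional using (Unique)
import Data.List.Relation.Unary.Unique.Propositional.Properties as Unique
open import Data.Maybe using (Maybe; just; nothing)
open import Data.Nat.DivMod using (m*n/n≡m)
import Data.Nat.Properties as ℕₚ
open import Data.Nat.Properties using (suc-injective)
open import Data.Nat.Tactic.RingSolver using (solve-∀)
open import Data.Sum using (_⊎_; inj₁; inj₂; [_,_]′)
open import Function.Base using (_∘_; id)
open import Function.Bundles using (Inverse; mk⇔)
open import Function.Properties.Inverse using (↔⇒↣)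
open import Level using (0ℓ)
open import Relation.Nullary using (contradiction; ¬?; Dec; yes; no)
open import Relation.Nullary.Decidable using (_×-dec_; map′)

-- Lists up to permutation

Unique-resp-↭ : ∀ {A : Set} {xs ys : List A} → xs ↭ ys → Unique xs → Unique ys
Unique-resp-↭ {A} xs↭ys = ↭ₛ.Unique-resp-↭ (≡.setoid A) (↭⇒↭ₛ xs↭ys)

∈⇒↭∷ : ∀ {A : Set} {x : A} {xs} → x ∈ xs → ∃ λ ys → xs ↭ x ∷ ys
∈⇒↭∷ x∈xs with as , bs , refl ← ∈-∃++ x∈xs = as ++ bs , shift _ as bs

module _ {A : Set} {x : A} {xs ys : List A} (xs↭x∷ys : xs ↭ x ∷ ys) where

  ↭∷⇒⊆ : ∀ {y} → y ∈ ys → y ∈ xs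
  ↭∷⇒⊆ = ∈-resp-↭ (↭-sym xs↭x∷ys) ∘ there

  ↭∷⇒∈ : ∀ {y} → y ∈ xs → y ≢ x → y ∈ ys
  ↭∷⇒∈ y∈xs y≢x with ∈-resp-↭ xs↭x∷ys y∈xs
  ... | here y≡x = contradiction y≡x y≢x
  ... | there y∈ys = y∈ys

  module _ (xs-unique : Unique xs) where

    ↭∷⇒Unique∷ : Unique (x ∷ ys)
    ↭∷⇒Unique∷ = Unique-resp-↭ xs↭x∷ys xs-unique

    ↭∷⇒Unique : Unique ys
    ↭∷⇒Unique = AllPairs.tail ↭∷⇒Unique∷

    ↭∷⇒∉ : x ∉ ys
    ↭∷⇒∉ = Unique.Unique[x∷xs]⇒x∉xs ↭∷⇒Unique∷

unique∧set⇒↭ : ∀ {A : Set} {xs ys : List A} → Unique xs → Unique ys →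
               (∀ {x} → x ∈ xs → x ∈ ys) → (∀ {x} → x ∈ ys → x ∈ xs) → xs ↭ ys
unique∧set⇒↭ xs-unique ys-unique ⊆ ⊇ = ∼bag⇒↭ (unique∧set⇒bag xs-unique ys-unique (mk⇔ ⊆ ⊇))

module CommutativeMonoidFold {A : Set} {_∙_ : Op₂ A} {ε : A}
                             (isCommutativeMonoid : IsCommutativeMonoid _≡_ _∙_ ε) where

  open IsCommutativeMonoid isCommutativeMonoid using (assoc; identityˡ)

  commutativeMonoid : CommutativeMonoid 0ℓ 0ℓ
  commutativeMonoid = record { isCommutativeMonoid = isCommutativeMonoid }

  open import Algebra.Properties.Monoid.Mult (CommutativeMonoid.monoid commutativeMonoid) public
    using () renaming (_×_ to _times_)

  fold : List A → A
  fold = foldr _∙_ ε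

  fold-++ : ∀ xs ys → fold (xs ++ ys) ≡ fold xs ∙ fold ys
  fold-++ []       ys = sym (identityˡ (fold ys))
  fold-++ (x ∷ xs) ys = trans (cong (x ∙_) (fold-++ xs ys)) (sym (assoc x (fold xs) (fold ys)))

  fold-↭ : ∀ {xs ys} → xs ↭ ys → fold xs ≡ fold ys
  fold-↭ p = ↭ₛ.foldr-commMonoid (≡.setoid A) isCommutativeMonoid (↭⇒↭ₛ p)

  fold-involution : (σ : A → A) (c : A) → ∀ k xs → length xs ≡ k ℕ.* 2 → Unique xs →
                    (∀ {x} → x ∈ xs → σ x ∈ xs) → (∀ {x} → x ∈ xs → σ (σ x) ≡ x) →
                    (∀ {x} → x ∈ xs → σ x ≢ x) → (∀ {x} → x ∈ xs → x ∙ σ x ≡ c) →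
                    fold xs ≡ k times c
  fold-involution σ c zero    []       _   _ _ _ _ _ = refl
  fold-involution σ c (suc k) (x ∷ xs) len u closed involutive no-fixed pair = begin
    x ∙ fold xs          ≡⟨ cong (x ∙_) (fold-↭ xs↭) ⟩
    x ∙ (σ x ∙ fold ys)  ≡⟨ assoc x (σ x) (fold ys) ⟨
    (x ∙ σ x) ∙ fold ys  ≡⟨ cong₂ _∙_ (pair (here refl)) (fold-involution σ c k ys len′ ys-unique
                              closed′ (involutive ∘ ⊆x∷xs) (no-fixed ∘ ⊆x∷xs) (pair ∘ ⊆x∷xs)) ⟩
    c ∙ (k times c)      ∎
    where
    open ≡-Reasoning
    σx∈xs : σ x ∈ xs
    σx∈xs with closed (here refl)
    ... | here σx≡x = contradiction σx≡x (no-fixed (here refl))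
    ... | there σx∈xs = σx∈xs
    ys = proj₁ (∈⇒↭∷ σx∈xs)
    xs↭ : xs ↭ σ x ∷ ys
    xs↭ = proj₂ (∈⇒↭∷ σx∈xs)
    x∷xs↭ : x ∷ xs ↭ x ∷ σ x ∷ ys
    x∷xs↭ = prep x xs↭
    ⊆x∷xs : ∀ {y} → y ∈ ys → y ∈ x ∷ xs
    ⊆x∷xs = ↭∷⇒⊆ x∷xs↭ ∘ there
    xs-unique : Unique xs
    xs-unique = AllPairs.tail u
    σx∉ys : σ x ∉ ys
    σx∉ys = ↭∷⇒∉ xs↭ xs-unique
    ys-unique : Unique ys
    ys-unique = ↭∷⇒Unique xs↭ xs-unique
    x∉ys : x ∉ ys
    x∉ys = ↭∷⇒∉ x∷xs↭ u ∘ there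
    σ-injective : ∀ {y z} → y ∈ x ∷ xs → z ∈ x ∷ xs → σ y ≡ σ z → y ≡ z
    σ-injective y∈ z∈ σy≡σz = trans (sym (involutive y∈)) (trans (cong σ σy≡σz) (involutive z∈))
    closed′ : ∀ {y} → y ∈ ys → σ y ∈ ys
    closed′ {y} y∈ys = ↭∷⇒∈ ↭-refl (↭∷⇒∈ x∷xs↭ (closed y∈) σy≢x) σy≢σx
      where
      y∈ = ⊆x∷xs y∈ys
      σy≢x : σ y ≢ x
      σy≢x σy≡x = σx∉ys (subst (_∈ ys)
        (σ-injective y∈ (closed (here refl)) (trans σy≡x (sym (involutive (here refl))))) y∈ys)
      σy≢σx : σ y ≢ σ x
      σy≢σx σy≡σx = x∉ys (subst (_∈ ys) (σ-injective y∈ (here refl) σy≡σx) y∈ys)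
    len′ : length ys ≡ k ℕ.* 2
    len′ = suc-injective (trans (sym (↭-length xs↭)) (suc-injective len))

-- Arithmetic of (3^j - 1) / 2

⌊3^_/2⌋ : ℕ → ℕ
⌊3^ zero /2⌋  = 0
⌊3^ suc j /2⌋ = suc (3 ℕ.* ⌊3^ j /2⌋)

3^≡1+⌊3^/2⌋*2 : ∀ j → 3 ℕ.^ j ≡ suc (⌊3^ j /2⌋ ℕ.* 2)
3^≡1+⌊3^/2⌋*2 zero    = refl
3^≡1+⌊3^/2⌋*2 (suc j) = begin
  3 ℕ.* 3 ℕ.^ j                 ≡⟨ cong (3 ℕ.*_) (3^≡1+⌊3^/2⌋*2 j) ⟩
  3 ℕ.* suc (h ℕ.* 2)           ≡⟨ lemma h ⟩
  suc (suc (3 ℕ.* h) ℕ.* 2)     ∎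
  where
  open ≡-Reasoning
  h = ⌊3^ j /2⌋
  lemma : ∀ h → 3 ℕ.* suc (h ℕ.* 2) ≡ suc (suc (3 ℕ.* h) ℕ.* 2)
  lemma = solve-∀

⌊3^/2⌋+3^≡⌊3^suc/2⌋ : ∀ j → ⌊3^ j /2⌋ ℕ.+ 3 ℕ.^ j ≡ ⌊3^ suc j /2⌋
⌊3^/2⌋+3^≡⌊3^suc/2⌋ j = trans (cong (⌊3^ j /2⌋ ℕ.+_) (3^≡1+⌊3^/2⌋*2 j)) (lemma ⌊3^ j /2⌋)
  where
  lemma : ∀ h → h ℕ.+ suc (h ℕ.* 2) ≡ suc (3 ℕ.* h)
  lemma = solve-∀

[3^-1]/2≡⌊3^/2⌋ : ∀ j → (3 ℕ.^ j ∸ 1) ℕ./ 2 ≡ ⌊3^ j /2⌋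
[3^-1]/2≡⌊3^/2⌋ j = trans (cong (λ m → (m ∸ 1) ℕ./ 2) (3^≡1+⌊3^/2⌋*2 j)) (m*n/n≡m ⌊3^ j /2⌋ 2)

[3^+3^]/2≡1+⌊3^/2⌋+⌊3^/2⌋ : ∀ j k → (3 ℕ.^ j ℕ.+ 3 ℕ.^ k) ℕ./ 2 ≡ suc (⌊3^ j /2⌋ ℕ.+ ⌊3^ k /2⌋)
[3^+3^]/2≡1+⌊3^/2⌋+⌊3^/2⌋ j k = begin
  (3 ℕ.^ j ℕ.+ 3 ℕ.^ k) ℕ./ 2
    ≡⟨ cong₂ (λ a b → (a ℕ.+ b) ℕ./ 2) (3^≡1+⌊3^/2⌋*2 j) (3^≡1+⌊3^/2⌋*2 k) ⟩
  (suc (⌊3^ j /2⌋ ℕ.* 2) ℕ.+ suc (⌊3^ k /2⌋ ℕ.* 2)) ℕ./ 2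
    ≡⟨ cong (ℕ._/ 2) (lemma ⌊3^ j /2⌋ ⌊3^ k /2⌋) ⟩
  suc (⌊3^ j /2⌋ ℕ.+ ⌊3^ k /2⌋) ℕ.* 2 ℕ./ 2
    ≡⟨ m*n/n≡m _ 2 ⟩
  suc (⌊3^ j /2⌋ ℕ.+ ⌊3^ k /2⌋) ∎
  where
  open ≡-Reasoning
  lemma : ∀ a b → suc (a ℕ.* 2) ℕ.+ suc (b ℕ.* 2) ≡ suc (a ℕ.+ b) ℕ.* 2
  lemma = solve-∀

-- A ring solver with constants in ℤ/3, valid in every commutative ring of characteristic 3

data ℤ/3 : Set where
  0ₘ 1ₘ 2ₘ : ℤ/3

_+ₘ_ : ℤ/3 → ℤ/3 → ℤ/3
0ₘ +ₘ y  = y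
1ₘ +ₘ 0ₘ = 1ₘ
1ₘ +ₘ 1ₘ = 2ₘ
1ₘ +ₘ 2ₘ = 0ₘ
2ₘ +ₘ 0ₘ = 2ₘ
2ₘ +ₘ 1ₘ = 0ₘ
2ₘ +ₘ 2ₘ = 1ₘ

_*ₘ_ : ℤ/3 → ℤ/3 → ℤ/3
0ₘ *ₘ y  = 0ₘ
1ₘ *ₘ y  = y
2ₘ *ₘ 0ₘ = 0ₘ
2ₘ *ₘ 1ₘ = 2ₘ
2ₘ *ₘ 2ₘ = 1ₘ

-ₘ_ : ℤ/3 → ℤ/3
-ₘ 0ₘ = 0ₘ
-ₘ 1ₘ = 2ₘ
-ₘ 2ₘ = 1ₘ

ℤ/3-rawRing : RawRing _ _
ℤ/3-rawRing = record
  { Carrier = ℤ/3 ; _≈_ = _≡_ ; _+_ = _+ₘ_ ; _*_ = _*ₘ_ ; -_ = -ₘ_ ; 0# = 0ₘ ; 1# = 1ₘ }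

module CharacteristicThree {c ℓ} (R : CommutativeRing c ℓ) where

  open CommutativeRing R renaming (refl to ≈-refl; sym to ≈-sym; trans to ≈-trans; setoid to ≈-setoid)
  open import Algebra.Properties.Ring ring
    using (-‿involutive; -1*x≈-x; +-inverseʳ-unique; -0#≈0#; -‿anti-homo-+)
  open import Relation.Binary.Reasoning.Setoid ≈-setoid

  module Solver (characteristic-three : 1# + (1# + 1#) ≈ 0#) where

    1+1≈-1 : 1# + 1# ≈ - 1#
    1+1≈-1 = +-inverseʳ-unique 1# (1# + 1#) characteristic-three

    -1+-1≈1 : - 1# + - 1# ≈ 1#
    -1+-1≈1 = begin
      - 1# + - 1#     ≈⟨ -‿anti-homo-+ 1# 1# ⟨
      - (1# + 1#)     ≈⟨ -‿cong 1+1≈-1 ⟩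
      - (- 1#)        ≈⟨ -‿involutive 1# ⟩
      1#              ∎

    -1*-1≈1 : - 1# * - 1# ≈ 1#
    -1*-1≈1 = ≈-trans (-1*x≈-x (- 1#)) (-‿involutive 1#)

    fromℤ/3 : ℤ/3 → Carrier
    fromℤ/3 0ₘ = 0#
    fromℤ/3 1ₘ = 1#
    fromℤ/3 2ₘ = - 1#

    +-homo : ∀ x y → fromℤ/3 (x +ₘ y) ≈ fromℤ/3 x + fromℤ/3 y
    +-homo 0ₘ y  = ≈-sym (+-identityˡ _)
    +-homo 1ₘ 0ₘ = ≈-sym (+-identityʳ _)
    +-homo 1ₘ 1ₘ = ≈-sym 1+1≈-1
    +-homo 1ₘ 2ₘ = ≈-sym (-‿inverseʳ 1#)
    +-homo 2ₘ 0ₘ = ≈-sym (+-identityʳ _)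
    +-homo 2ₘ 1ₘ = ≈-sym (-‿inverseˡ 1#)
    +-homo 2ₘ 2ₘ = ≈-sym -1+-1≈1

    *-homo : ∀ x y → fromℤ/3 (x *ₘ y) ≈ fromℤ/3 x * fromℤ/3 y
    *-homo 0ₘ y  = ≈-sym (zeroˡ _)
    *-homo 1ₘ y  = ≈-sym (*-identityˡ _)
    *-homo 2ₘ 0ₘ = ≈-sym (zeroʳ _)
    *-homo 2ₘ 1ₘ = ≈-sym (*-identityʳ _)
    *-homo 2ₘ 2ₘ = ≈-sym -1*-1≈1

    -‿homo : ∀ x → fromℤ/3 (-ₘ x) ≈ - fromℤ/3 x
    -‿homo 0ₘ = ≈-sym -0#≈0#
    -‿homo 1ₘ = ≈-refl
    -‿homo 2ₘ = ≈-sym (-‿involutive 1#)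

    morphism : ℤ/3-rawRing -Raw-AlmostCommutative⟶ fromCommutativeRing R
    morphism = record
      { ⟦_⟧ = fromℤ/3 ; +-homo = +-homo ; *-homo = *-homo ; -‿homo = -‿homo ; 0-homo = ≈-refl ; 1-homo = ≈-refl }

    fromℤ/3-equal? : ∀ x y → Maybe (fromℤ/3 x ≈ fromℤ/3 y)
    fromℤ/3-equal? 0ₘ 0ₘ = just ≈-refl
    fromℤ/3-equal? 1ₘ 1ₘ = just ≈-refl
    fromℤ/3-equal? 2ₘ 2ₘ = just ≈-refl
    fromℤ/3-equal? _  _  = nothing

    open import Algebra.Solver.Ring ℤ/3-rawRing (fromCommutativeRing R) morphism fromℤ/3-equal? public

module FiniteField {n : ℕ} (F : GF3 n) where

  open GF3 F

  commutativeRing : CommutativeRing 0ℓ 0ℓ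
  commutativeRing = record { isCommutativeRing = isCommutativeRing }

  open CommutativeRing commutativeRing public
    using ( +-isCommutativeMonoid; *-isCommutativeMonoid; ring; semiring
          ; +-assoc; +-identityˡ; +-identityʳ; -‿inverseʳ
          ; *-assoc; *-comm; *-identityˡ; *-identityʳ; zeroˡ; zeroʳ; distribˡ; distribʳ)
  open import Algebra.Properties.Ring ring public
    using ( -‿involutive; -‿injective; -0#≈0#; +-cancelˡ; +-identityˡ-unique; +-inverseˡ-unique
          ; x∙y⁻¹≈ε⇒x≈y)
  open import Algebra.Properties.Semiring.Mult semiring using (×1-homo-*)
  open Inverse card using (to; from; strictlyInverseˡ; strictlyInverseʳ)
  open ≡-Reasoning

  module Additive = CommutativeMonoidFold +-isCommutativeMonoid
  module Multiplicative = CommutativeMonoidFold *-isCommutativeMonoid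

  infix 4 _≟_
  _≟_ : (x y : Carrier) → Dec (x ≡ y)
  _≟_ = inj⇒≟ (↔⇒↣ card)

  x⁻¹*[x*y]≡y : ∀ {x} y → x ≢ 0# → x ⁻¹ * (x * y) ≡ y
  x⁻¹*[x*y]≡y {x} y x≢0 = begin
    x ⁻¹ * (x * y)   ≡⟨ *-assoc (x ⁻¹) x y ⟨
    (x ⁻¹ * x) * y   ≡⟨ cong (_* y) (trans (*-comm (x ⁻¹) x) (inverseʳ x x≢0)) ⟩
    1# * y           ≡⟨ *-identityˡ y ⟩
    y                ∎

  x*[x⁻¹*y]≡y : ∀ {x} y → x ≢ 0# → x * (x ⁻¹ * y) ≡ y
  x*[x⁻¹*y]≡y {x} y x≢0 = begin
    x * (x ⁻¹ * y)   ≡⟨ *-assoc x (x ⁻¹) y ⟨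
    (x * x ⁻¹) * y   ≡⟨ cong (_* y) (inverseʳ x x≢0) ⟩
    1# * y           ≡⟨ *-identityˡ y ⟩
    y                ∎

  *-cancelˡ : ∀ {x y z} → x ≢ 0# → x * y ≡ x * z → y ≡ z
  *-cancelˡ {x} {y} {z} x≢0 xy≡xz = begin
    y                ≡⟨ x⁻¹*[x*y]≡y y x≢0 ⟨
    x ⁻¹ * (x * y)   ≡⟨ cong (x ⁻¹ *_) xy≡xz ⟩
    x ⁻¹ * (x * z)   ≡⟨ x⁻¹*[x*y]≡y z x≢0 ⟩
    z                ∎

  *-nonzero : ∀ {x y} → x ≢ 0# → y ≢ 0# → x * y ≢ 0#
  *-nonzero {x} x≢0 y≢0 xy≡0 = y≢0 (*-cancelˡ x≢0 (trans xy≡0 (sym (zeroʳ x))))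

  x*y≡0⇒ : ∀ {x y} → x * y ≡ 0# → x ≡ 0# ⊎ y ≡ 0#
  x*y≡0⇒ {x} {y} xy≡0 with x ≟ 0# | y ≟ 0#
  ... | yes x≡0 | _       = inj₁ x≡0
  ... | _       | yes y≡0 = inj₂ y≡0
  ... | no x≢0  | no y≢0  = contradiction xy≡0 (*-nonzero x≢0 y≢0)

  ^-nonzero : ∀ {x} k → x ≢ 0# → x ^ k ≢ 0#
  ^-nonzero zero    _   = 0≢1 ∘ sym
  ^-nonzero (suc k) x≢0 = *-nonzero x≢0 (^-nonzero k x≢0)

  x^k≡0⇒x≡0 : ∀ {x} k → x ^ k ≡ 0# → x ≡ 0#
  x^k≡0⇒x≡0 {x} k x^k≡0 with x ≟ 0#
  ... | yes x≡0 = x≡0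
  ... | no x≢0  = contradiction x^k≡0 (^-nonzero k x≢0)

  ^-homo-* : ∀ x m k → x ^ (m ℕ.+ k) ≡ x ^ m * x ^ k
  ^-homo-* x zero    k = sym (*-identityˡ _)
  ^-homo-* x (suc m) k = trans (cong (x *_) (^-homo-* x m k)) (sym (*-assoc _ _ _))

  ^-distrib-* : ∀ x y k → (x * y) ^ k ≡ x ^ k * y ^ k
  ^-distrib-* x y zero    = sym (*-identityˡ 1#)
  ^-distrib-* x y (suc k) = begin
    (x * y) * (x * y) ^ k        ≡⟨ cong ((x * y) *_) (^-distrib-* x y k) ⟩
    (x * y) * (x ^ k * y ^ k)    ≡⟨ interchange x y (x ^ k) (y ^ k) ⟩
    (x * x ^ k) * (y * y ^ k)    ∎
    where open import Algebra.Properties.CommutativeSemigroup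
            (CommutativeRing.*-commutativeSemigroup commutativeRing) using (interchange)

  1^k≡1 : ∀ k → 1# ^ k ≡ 1#
  1^k≡1 zero    = refl
  1^k≡1 (suc k) = trans (*-identityˡ _) (1^k≡1 k)

  ^-assocʳ : ∀ x m k → (x ^ m) ^ k ≡ x ^ (m ℕ.* k)
  ^-assocʳ x zero    k = 1^k≡1 k
  ^-assocʳ x (suc m) k = begin
    (x * x ^ m) ^ k         ≡⟨ ^-distrib-* x (x ^ m) k ⟩
    x ^ k * (x ^ m) ^ k     ≡⟨ cong (x ^ k *_) (^-assocʳ x m k) ⟩
    x ^ k * x ^ (m ℕ.* k)   ≡⟨ ^-homo-* x k (m ℕ.* k) ⟨
    x ^ (k ℕ.+ m ℕ.* k)     ∎

  ^≡times : ∀ x k → x ^ k ≡ k Multiplicative.times x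
  ^≡times x zero    = refl
  ^≡times x (suc k) = cong (x *_) (^≡times x k)

  elements : List Carrier
  elements = tabulate from

  elements-unique : Unique elements
  elements-unique = Unique.tabulate⁺ λ {i} {j} fromi≡fromj →
    trans (sym (strictlyInverseˡ i)) (trans (cong to fromi≡fromj) (strictlyInverseˡ j))

  length-elements : length elements ≡ 3 ℕ.^ n
  length-elements = length-tabulate from

  ∈-elements : ∀ x → x ∈ elements
  ∈-elements x = subst (_∈ elements) (strictlyInverseʳ x) (∈-tabulate⁺ (to x))

  C₀? : ∀ a → Dec (C₀ a)
  C₀? a = map′ satisfied (λ a∈C₀ → lose (∈-elements (proj₁ a∈C₀)) (proj₂ a∈C₀))
               (any? (λ e → ¬? (e ≟ 0#) ×-dec (e * e ≟ a)) elements)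

  sum-map-1+ : ∀ xs → sumF (map (1# +_) xs) ≡ length xs Additive.times 1# + sumF xs
  sum-map-1+ []       = sym (+-identityˡ 0#)
  sum-map-1+ (x ∷ xs) = begin
    (1# + x) + sumF (map (1# +_) xs)          ≡⟨ cong ((1# + x) +_) (sum-map-1+ xs) ⟩
    (1# + x) + (length xs Additive.times 1# + sumF xs)
      ≡⟨ interchange 1# x (length xs Additive.times 1#) (sumF xs) ⟩
    (1# + length xs Additive.times 1#) + (x + sumF xs) ∎
    where open import Algebra.Properties.CommutativeSemigroup
            (CommutativeRing.+-commutativeSemigroup commutativeRing) using (interchange)

  3^n×1≡0 : (3 ℕ.^ n) Additive.times 1# ≡ 0#
  3^n×1≡0 = +-identityˡ-unique _ (sumF elements) (begin
    (3 ℕ.^ n) Additive.times 1# + sumF elements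
      ≡⟨ cong (λ k → k Additive.times 1# + sumF elements) length-elements ⟨
    length elements Additive.times 1# + sumF elements
      ≡⟨ sum-map-1+ elements ⟨
    sumF (map (1# +_) elements)
      ≡⟨ Additive.fold-↭ (unique∧set⇒↭ (Unique.map⁺ (+-cancelˡ 1# _ _) elements-unique) elements-unique
            (λ {x} _ → ∈-elements x) (λ {y} _ → subst (_∈ map (1# +_) elements) (1+[-1+y]≡y y)
                                                   (∈-map⁺ (1# +_) (∈-elements (- 1# + y))))) ⟩
    sumF elements ∎)
    where
    1+[-1+y]≡y : ∀ y → 1# + (- 1# + y) ≡ y
    1+[-1+y]≡y y = trans (sym (+-assoc 1# (- 1#) y)) (trans (cong (_+ y) (-‿inverseʳ 1#)) (+-identityˡ y))

  ×1-homo-^ : ∀ m k → (m ℕ.^ k) Additive.times 1# ≡ (m Additive.times 1#) ^ k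
  ×1-homo-^ m zero    = +-identityʳ 1#
  ×1-homo-^ m (suc k) = trans (×1-homo-* m (m ℕ.^ k)) (cong ((m Additive.times 1#) *_) (×1-homo-^ m k))

  characteristic-three : 1# + (1# + 1#) ≡ 0#
  characteristic-three = begin
    1# + (1# + 1#)         ≡⟨ cong (λ x → 1# + (1# + x)) (+-identityʳ 1#) ⟨
    3 Additive.times 1#    ≡⟨ x^k≡0⇒x≡0 n (trans (sym (×1-homo-^ 3 n)) 3^n×1≡0) ⟩
    0#                     ∎

  open CharacteristicThree commutativeRing
  open Solver characteristic-three public

  x≢-x : ∀ {x} → x ≢ 0# → x ≢ - x
  x≢-x {x} x≢0 x≡-x = x≢0 (begin
    x              ≡⟨ solve 1 (λ x → x := :- (x :+ x)) refl x ⟩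
    - (x + x)      ≡⟨ cong (λ y → - (x + y)) x≡-x ⟩
    - (x + - x)    ≡⟨ cong -_ (-‿inverseʳ x) ⟩
    - 0#           ≡⟨ -0#≈0# ⟩
    0#             ∎)

  square-roots : ∀ {x y} → x * x ≡ y * y → x ≡ y ⊎ x ≡ - y
  square-roots {x} {y} xx≡yy with x*y≡0⇒ (begin
      (x - y) * (x + y)   ≡⟨ solve 2 (λ x y → (x :- y) :* (x :+ y) := x :* x :- y :* y) refl x y ⟩
      x * x - y * y       ≡⟨ cong (_- y * y) xx≡yy ⟩
      y * y - y * y       ≡⟨ -‿inverseʳ (y * y) ⟩
      0#                  ∎)
  ... | inj₁ x-y≡0 = inj₁ (x∙y⁻¹≈ε⇒x≈y x y x-y≡0)
  ... | inj₂ x+y≡0 = inj₂ (+-inverseˡ-unique x y x+y≡0)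

  ⁻¹-nonzero : ∀ {x} → x ≢ 0# → x ⁻¹ ≢ 0#
  ⁻¹-nonzero {x} x≢0 x⁻¹≡0 = 0≢1 (begin
    0#         ≡⟨ zeroʳ x ⟨
    x * 0#     ≡⟨ cong (x *_) x⁻¹≡0 ⟨
    x * x ⁻¹   ≡⟨ inverseʳ x x≢0 ⟩
    1#         ∎)

  ⁻¹-unique : ∀ {x y} → x ≢ 0# → x * y ≡ 1# → x ⁻¹ ≡ y
  ⁻¹-unique {x} {y} x≢0 xy≡1 = *-cancelˡ x≢0 (trans (inverseʳ x x≢0) (sym xy≡1))

  _/_ : Carrier → Carrier → Carrier
  x / y = x * y ⁻¹

  y*[x/y]≡x : ∀ x {y} → y ≢ 0# → y * (x / y) ≡ x
  y*[x/y]≡x x {y} y≢0 = begin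
    y * (x * y ⁻¹)   ≡⟨ solve 3 (λ x y z → y :* (x :* z) := x :* (y :* z)) refl x y (y ⁻¹) ⟩
    x * (y * y ⁻¹)   ≡⟨ cong (x *_) (inverseʳ y y≢0) ⟩
    x * 1#           ≡⟨ *-identityʳ x ⟩
    x                ∎

  /-nonzero : ∀ {x y} → x ≢ 0# → y ≢ 0# → x / y ≢ 0#
  /-nonzero x≢0 y≢0 = *-nonzero x≢0 (⁻¹-nonzero y≢0)

  x/[x/y]≡y : ∀ {x y} → x ≢ 0# → y ≢ 0# → x / (x / y) ≡ y
  x/[x/y]≡y {x} {y} x≢0 y≢0 = *-cancelˡ (/-nonzero x≢0 y≢0)
    (trans (y*[x/y]≡x x (/-nonzero x≢0 y≢0)) (sym (trans (*-comm (x / y) y) (y*[x/y]≡x x y≢0))))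

  x/y≡z⇒x≡y*z : ∀ {x y z} → y ≢ 0# → x / y ≡ z → x ≡ y * z
  x/y≡z⇒x≡y*z {x} y≢0 x/y≡z = trans (sym (y*[x/y]≡x x y≢0)) (cong (_ *_) x/y≡z)

module EulerCriterion {n : ℕ} (F : GF3 n) where

  open GF3 F
  open FiniteField F
  open ≡-Reasoning

  product : List Carrier → Carrier
  product = Multiplicative.fold

  nonzero : List Carrier
  nonzero = proj₁ (∈⇒↭∷ (∈-elements 0#))

  elements↭0∷nonzero : elements ↭ 0# ∷ nonzero
  elements↭0∷nonzero = proj₂ (∈⇒↭∷ (∈-elements 0#))

  nonzero-unique : Unique nonzero
  nonzero-unique = ↭∷⇒Unique elements↭0∷nonzero elements-unique

  ∈-nonzero : ∀ {x} → x ≢ 0# → x ∈ nonzero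
  ∈-nonzero {x} = ↭∷⇒∈ elements↭0∷nonzero (∈-elements x)

  ∈-nonzero⁻ : ∀ {x} → x ∈ nonzero → x ≢ 0#
  ∈-nonzero⁻ x∈nonzero refl = ↭∷⇒∉ elements↭0∷nonzero elements-unique x∈nonzero

  length-nonzero : length nonzero ≡ N ℕ.* 2
  length-nonzero = suc-injective (begin
    suc (length nonzero)    ≡⟨ ↭-length elements↭0∷nonzero ⟨
    length elements         ≡⟨ length-elements ⟩
    3 ℕ.^ n                 ≡⟨ 3^≡1+⌊3^/2⌋*2 n ⟩
    suc (⌊3^ n /2⌋ ℕ.* 2)   ≡⟨ cong (λ k → suc (k ℕ.* 2)) ([3^-1]/2≡⌊3^/2⌋ n) ⟨
    suc (N ℕ.* 2)           ∎)

  product-nonzero≡a^N : ∀ {a} → C₁ a → product nonzero ≡ a ^ N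
  product-nonzero≡a^N {a} (a≢0 , a-nonsquare) = begin
    product nonzero
      ≡⟨ Multiplicative.fold-involution (a /_) a N nonzero length-nonzero nonzero-unique
           (λ x∈ → ∈-nonzero (/-nonzero a≢0 (∈-nonzero⁻ x∈)))
           (λ x∈ → x/[x/y]≡y a≢0 (∈-nonzero⁻ x∈))
           (λ {x} x∈ a/x≡x → a-nonsquare (x , ∈-nonzero⁻ x∈ , sym (x/y≡z⇒x≡y*z (∈-nonzero⁻ x∈) a/x≡x)))
           (λ x∈ → y*[x/y]≡x a (∈-nonzero⁻ x∈)) ⟩
    N Multiplicative.times a   ≡⟨ ^≡times a N ⟨
    a ^ N                      ∎

  -- Pair x with b² / x; the fixed points b and -b are set aside.
  module _ {b} (b≢0 : b ≢ 0#) where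

    private
      b² : Carrier
      b² = b * b

      -b≢0 : - b ≢ 0#
      -b≢0 -b≡0 = b≢0 (trans (sym (-‿involutive b)) (trans (cong -_ -b≡0) -0#≈0#))

      L : List Carrier
      L = proj₁ (∈⇒↭∷ (∈-nonzero b≢0))

      -b∈L : - b ∈ L
      -b∈L = ↭∷⇒∈ (proj₂ (∈⇒↭∷ (∈-nonzero b≢0))) (∈-nonzero -b≢0) (x≢-x b≢0 ∘ sym)

      rest : List Carrier
      rest = proj₁ (∈⇒↭∷ -b∈L)

      nonzero↭±b∷rest : nonzero ↭ b ∷ - b ∷ rest
      nonzero↭±b∷rest = ↭-trans (proj₂ (∈⇒↭∷ (∈-nonzero b≢0))) (prep b (proj₂ (∈⇒↭∷ -b∈L)))

      ±b∷rest-unique : Unique (b ∷ - b ∷ rest)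
      ±b∷rest-unique = Unique-resp-↭ nonzero↭±b∷rest nonzero-unique

      ∈-rest⁻ : ∀ {y} → y ∈ rest → y ≢ 0# × y ≢ b × y ≢ - b
      ∈-rest⁻ y∈ = ∈-nonzero⁻ (↭∷⇒⊆ nonzero↭±b∷rest (there y∈))
                 , (λ { refl → ↭∷⇒∉ ↭-refl ±b∷rest-unique (there y∈) })
                 , (λ { refl → ↭∷⇒∉ ↭-refl (AllPairs.tail ±b∷rest-unique) y∈ })

      ∈-rest : ∀ {y} → y ≢ 0# → y ≢ b → y ≢ - b → y ∈ rest
      ∈-rest y≢0 y≢b y≢-b = ↭∷⇒∈ ↭-refl (↭∷⇒∈ nonzero↭±b∷rest (∈-nonzero y≢0) y≢b) y≢-b

      rest-nonzero : ∀ {y} → y ∈ rest → y ≢ 0#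
      rest-nonzero = proj₁ ∘ ∈-rest⁻

      b²/-closed : ∀ {y} → y ∈ rest → b² / y ∈ rest
      b²/-closed {y} y∈ with ∈-rest⁻ y∈
      ... | y≢0 , y≢b , y≢-b = ∈-rest (/-nonzero (*-nonzero b≢0 b≢0) y≢0)
        (λ b²/y≡b → y≢b (sym (*-cancelˡ b≢0 (trans (x/y≡z⇒x≡y*z y≢0 b²/y≡b) (*-comm y b)))))
        (λ b²/y≡-b → y≢-b (trans (sym (-‿involutive y)) (cong -_ (sym (*-cancelˡ b≢0
           (trans (x/y≡z⇒x≡y*z y≢0 b²/y≡-b) (solve 2 (λ y b → y :* :- b := b :* :- y) refl y b)))))))

      b²/-fixed-point-free : ∀ {y} → y ∈ rest → b² / y ≢ y
      b²/-fixed-point-free y∈ b²/y≡y with ∈-rest⁻ y∈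
      ... | y≢0 , y≢b , y≢-b = [ y≢b , y≢-b ]′ (square-roots (sym (x/y≡z⇒x≡y*z y≢0 b²/y≡y)))

    product-nonzero≡-[b*b]^N : product nonzero ≡ - ((b * b) ^ N)
    product-nonzero≡-[b*b]^N = pair-off N length-nonzero
      where
      pair-off : ∀ k → length nonzero ≡ k ℕ.* 2 → product nonzero ≡ - (b² ^ k)
      pair-off zero len with () ← trans (sym (↭-length nonzero↭±b∷rest)) len
      pair-off (suc k) len = begin
        product nonzero                        ≡⟨ Multiplicative.fold-↭ nonzero↭±b∷rest ⟩
        b * (- b * product rest)               ≡⟨ cong (λ p → b * (- b * p)) product-rest ⟩
        b * (- b * k Multiplicative.times b²)  ≡⟨ cong (λ p → b * (- b * p)) (^≡times b² k) ⟨
        b * (- b * b² ^ k)                     ≡⟨ solve 2 (λ b p → b :* (:- b :* p) := :- (b :* b :* p))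
                                                    refl b (b² ^ k) ⟩
        - (b² * b² ^ k)                        ∎
        where
        product-rest : product rest ≡ k Multiplicative.times b²
        product-rest = Multiplicative.fold-involution (b² /_) b² k rest
          (suc-injective (suc-injective (trans (sym (↭-length nonzero↭±b∷rest)) len)))
          (AllPairs.tail (AllPairs.tail ±b∷rest-unique)) b²/-closed
          (x/[x/y]≡y (*-nonzero b≢0 b≢0) ∘ rest-nonzero) b²/-fixed-point-free
          (y*[x/y]≡x b² ∘ rest-nonzero)

  product-nonzero≡-1 : product nonzero ≡ - 1#
  product-nonzero≡-1 = trans (product-nonzero≡-[b*b]^N (0≢1 ∘ sym))
                             (cong -_ (trans (cong (_^ N) (*-identityˡ 1#)) (1^k≡1 N)))

  C₀⇒^N≡1 : ∀ {a} → C₀ a → a ^ N ≡ 1#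
  C₀⇒^N≡1 (e , e≢0 , e*e≡a) = -‿injective (begin
    - (_ ^ N)        ≡⟨ cong (λ x → - (x ^ N)) e*e≡a ⟨
    - ((e * e) ^ N)  ≡⟨ product-nonzero≡-[b*b]^N e≢0 ⟨
    product nonzero  ≡⟨ product-nonzero≡-1 ⟩
    - 1#             ∎)

  C₁⇒^N≡-1 : ∀ {a} → C₁ a → a ^ N ≡ - 1#
  C₁⇒^N≡-1 a∈C₁ = trans (sym (product-nonzero≡a^N a∈C₁)) product-nonzero≡-1

module PowerSum {n : ℕ} (F : GF3 n) where

  open GF3 F
  open FiniteField F
  open ≡-Reasoning

  sumF-map-*ˡ : ∀ {A : Set} c (g : A → Carrier) xs → sumF (map (λ a → c * g a) xs) ≡ c * sumF (map g xs)
  sumF-map-*ˡ c g []       = sym (zeroʳ c)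
  sumF-map-*ˡ c g (a ∷ xs) = trans (cong (c * g a +_) (sumF-map-*ˡ c g xs)) (sym (distribˡ c (g a) _))

  sumF-concatMap-* : ∀ {A B : Set} (f : A → Carrier) (g : B → Carrier) xs ys →
                     sumF (concatMap (λ a → map (λ b → f a * g b) ys) xs) ≡ sumF (map f xs) * sumF (map g ys)
  sumF-concatMap-* f g []       ys = sym (zeroˡ _)
  sumF-concatMap-* f g (a ∷ xs) ys = begin
    sumF (map (λ b → f a * g b) ys ++ concatMap (λ a → map (λ b → f a * g b) ys) xs)
      ≡⟨ Additive.fold-++ (map (λ b → f a * g b) ys) _ ⟩
    sumF (map (λ b → f a * g b) ys) + sumF (concatMap (λ a → map (λ b → f a * g b) ys) xs)
      ≡⟨ cong₂ _+_ (sumF-map-*ˡ (f a) g ys) (sumF-concatMap-* f g xs ys) ⟩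
    f a * sumF (map g ys) + sumF (map f xs) * sumF (map g ys)
      ≡⟨ distribʳ (sumF (map g ys)) (f a) (sumF (map f xs)) ⟨
    (f a + sumF (map f xs)) * sumF (map g ys) ∎

  telescope : ∀ (b : ℕ → Carrier) k → sumF (applyUpTo (λ j → b (suc j) - b j) k) ≡ b k - b 0
  telescope b zero    = sym (-‿inverseʳ (b 0))
  telescope b (suc k) = begin
    (b 1 - b 0) + sumF (applyUpTo (λ j → b (suc (suc j)) - b (suc j)) k)
      ≡⟨ cong (b 1 - b 0 +_) (telescope (b ∘ suc) k) ⟩
    (b 1 - b 0) + (b (suc k) - b 1)
      ≡⟨ solve 3 (λ x y z → (y :- x) :+ (z :- y) := z :- x) refl (b 0) (b 1) (b (suc k)) ⟩
    b (suc k) - b 0 ∎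

  frobenius : ∀ j x y → (x - y) ^ (3 ℕ.^ j) ≡ x ^ (3 ℕ.^ j) - y ^ (3 ℕ.^ j)
  frobenius zero    x y = solve 2 (λ x y → (x :- y) :* con 1ₘ := x :* con 1ₘ :- y :* con 1ₘ) refl x y
  frobenius (suc j) x y = begin
    (x - y) ^ (3 ℕ.* 3 ℕ.^ j)                   ≡⟨ ^-assocʳ (x - y) 3 (3 ℕ.^ j) ⟨
    ((x - y) ^ 3) ^ (3 ℕ.^ j)                   ≡⟨ cong (_^ (3 ℕ.^ j)) (solve 2 (λ x y →
                                                     (x :- y) :^ 3 := x :^ 3 :- y :^ 3) refl x y) ⟩
    (x ^ 3 - y ^ 3) ^ (3 ℕ.^ j)                 ≡⟨ frobenius j (x ^ 3) (y ^ 3) ⟩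
    (x ^ 3) ^ (3 ℕ.^ j) - (y ^ 3) ^ (3 ℕ.^ j)   ≡⟨ cong₂ _-_ (^-assocʳ x 3 (3 ℕ.^ j)) (^-assocʳ y 3 (3 ℕ.^ j)) ⟩
    x ^ (3 ℕ.* 3 ℕ.^ j) - y ^ (3 ℕ.* 3 ℕ.^ j)   ∎

  powerSum : Carrier → Carrier
  powerSum w = sumF (map (λ j → w ^ ⌊3^ j /2⌋) (upTo n))

  powerSum-term : ∀ z j → (z - 1#) * (z * (z - 1#) ^ 2) ^ ⌊3^ j /2⌋ ≡ z ^ ⌊3^ suc j /2⌋ - z ^ ⌊3^ j /2⌋
  powerSum-term z j = begin
    (z - 1#) * (z * (z - 1#) ^ 2) ^ h
      ≡⟨ cong ((z - 1#) *_) (^-distrib-* z ((z - 1#) ^ 2) h) ⟩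
    (z - 1#) * (z ^ h * ((z - 1#) ^ 2) ^ h)
      ≡⟨ cong (λ w → (z - 1#) * (z ^ h * w)) (trans (^-assocʳ (z - 1#) 2 h) (cong ((z - 1#) ^_) (ℕₚ.*-comm 2 h))) ⟩
    (z - 1#) * (z ^ h * (z - 1#) ^ (h ℕ.* 2))
      ≡⟨ solve 3 (λ y p q → y :* (p :* q) := p :* (y :* q)) refl (z - 1#) (z ^ h) _ ⟩
    z ^ h * (z - 1#) ^ suc (h ℕ.* 2)
      ≡⟨ cong (λ k → z ^ h * (z - 1#) ^ k) (3^≡1+⌊3^/2⌋*2 j) ⟨
    z ^ h * (z - 1#) ^ (3 ℕ.^ j)
      ≡⟨ cong (z ^ h *_) (trans (frobenius j z 1#) (cong (λ w → z ^ (3 ℕ.^ j) - w) (1^k≡1 (3 ℕ.^ j)))) ⟩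
    z ^ h * (z ^ (3 ℕ.^ j) - 1#)
      ≡⟨ solve 2 (λ p q → p :* (q :- con 1ₘ) := p :* q :- p) refl (z ^ h) _ ⟩
    z ^ h * z ^ (3 ℕ.^ j) - z ^ h
      ≡⟨ cong (_- z ^ h) (^-homo-* z h (3 ℕ.^ j)) ⟨
    z ^ (h ℕ.+ 3 ℕ.^ j) - z ^ h
      ≡⟨ cong (λ k → z ^ k - z ^ h) (⌊3^/2⌋+3^≡⌊3^suc/2⌋ j) ⟩
    z ^ ⌊3^ suc j /2⌋ - z ^ h ∎
    where h = ⌊3^ j /2⌋

  powerSum-telescopes : ∀ z → (z - 1#) * powerSum (z * (z - 1#) ^ 2) ≡ z ^ N - 1#
  powerSum-telescopes z = begin
    (z - 1#) * sumF (map (λ j → W ^ ⌊3^ j /2⌋) (upTo n))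
      ≡⟨ sumF-map-*ˡ (z - 1#) (λ j → W ^ ⌊3^ j /2⌋) (upTo n) ⟨
    sumF (map (λ j → (z - 1#) * W ^ ⌊3^ j /2⌋) (upTo n))
      ≡⟨ cong sumF (map-cong (powerSum-term z) (upTo n)) ⟩
    sumF (map (λ j → z ^ ⌊3^ suc j /2⌋ - z ^ ⌊3^ j /2⌋) (upTo n))
      ≡⟨ cong sumF (map-applyUpTo id (λ j → z ^ ⌊3^ suc j /2⌋ - z ^ ⌊3^ j /2⌋) n) ⟩
    sumF (applyUpTo (λ j → z ^ ⌊3^ suc j /2⌋ - z ^ ⌊3^ j /2⌋) n)
      ≡⟨ telescope (λ j → z ^ ⌊3^ j /2⌋) n ⟩
    z ^ ⌊3^ n /2⌋ - 1#
      ≡⟨ cong (λ k → z ^ k - 1#) ([3^-1]/2≡⌊3^/2⌋ n) ⟨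
    z ^ N - 1# ∎
    where W = z * (z - 1#) ^ 2

  v≡θW·powerSum[W]² : ∀ β θ y → let W = β ⁻¹ * (θ ^ 3) ⁻¹ * y in
                      v β θ y ≡ (θ * W) * (powerSum W * powerSum W)
  v≡θW·powerSum[W]² β θ y = begin
    sumF (concatMap (λ j → map (λ k → θ * W ^ ((3 ℕ.^ j ℕ.+ 3 ℕ.^ k) ℕ./ 2)) (upTo n)) (upTo n))
      ≡⟨ cong sumF (concatMap-cong (λ j → map-cong (term j) (upTo n)) (upTo n)) ⟩
    sumF (concatMap (λ j → map (λ k → (θ * W * W ^ ⌊3^ j /2⌋) * W ^ ⌊3^ k /2⌋) (upTo n)) (upTo n))
      ≡⟨ sumF-concatMap-* (λ j → θ * W * W ^ ⌊3^ j /2⌋) (λ k → W ^ ⌊3^ k /2⌋) (upTo n) (upTo n) ⟩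
    sumF (map (λ j → θ * W * W ^ ⌊3^ j /2⌋) (upTo n)) * powerSum W
      ≡⟨ cong (_* powerSum W) (sumF-map-*ˡ (θ * W) (λ j → W ^ ⌊3^ j /2⌋) (upTo n)) ⟩
    (θ * W) * powerSum W * powerSum W
      ≡⟨ *-assoc (θ * W) (powerSum W) (powerSum W) ⟩
    (θ * W) * (powerSum W * powerSum W) ∎
    where
    W = β ⁻¹ * (θ ^ 3) ⁻¹ * y
    term : ∀ j k → θ * W ^ ((3 ℕ.^ j ℕ.+ 3 ℕ.^ k) ℕ./ 2) ≡ (θ * W * W ^ ⌊3^ j /2⌋) * W ^ ⌊3^ k /2⌋
    term j k = begin
      θ * W ^ ((3 ℕ.^ j ℕ.+ 3 ℕ.^ k) ℕ./ 2)
        ≡⟨ cong (λ e → θ * W ^ e) ([3^+3^]/2≡1+⌊3^/2⌋+⌊3^/2⌋ j k) ⟩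
      θ * (W * W ^ (⌊3^ j /2⌋ ℕ.+ ⌊3^ k /2⌋))
        ≡⟨ cong (λ w → θ * (W * w)) (^-homo-* W ⌊3^ j /2⌋ ⌊3^ k /2⌋) ⟩
      θ * (W * (W ^ ⌊3^ j /2⌋ * W ^ ⌊3^ k /2⌋))
        ≡⟨ solve 4 (λ θ w p q → θ :* (w :* (p :* q)) := θ :* w :* p :* q) refl θ W (W ^ ⌊3^ j /2⌋) (W ^ ⌊3^ k /2⌋) ⟩
      (θ * W * W ^ ⌊3^ j /2⌋) * W ^ ⌊3^ k /2⌋ ∎

module InverseFormula {n : ℕ} (F : GF3 n) where

  open GF3 F
  open FiniteField F
  open EulerCriterion F
  open PowerSum F
  open ≡-Reasoning

  sgn*sgn≡1 : ∀ m → sgn m * sgn m ≡ 1#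
  sgn*sgn≡1 zero    = *-identityˡ 1#
  sgn*sgn≡1 (suc m) = trans (solve 1 (λ s → (:- con 1ₘ :* s) :* (:- con 1ₘ :* s) := s :* s) refl (sgn m))
                            (sgn*sgn≡1 m)

  -- finv y is u(y) where sgn m · y^N = 1 and v(y) where sgn m · y^N = -1.
  finv≡ : ∀ α β θ s m y →
          finv α β θ s m y ≡ (v β θ y - u α s y) * (sgn m * y ^ N) - (u α s y + v β θ y)
  finv≡ α β θ s m y = solve 4 (λ U V S P →
      :- (U :* (con 1ₘ :+ S :* P)) :- V :* (con 1ₘ :+ (:- con 1ₘ :* S) :* P)
    := (V :- U) :* (S :* P) :- (U :+ V))
    refl (u α s y) (v β θ y) (sgn m) (y ^ N)

  finv≡u : ∀ α β θ s m {y} → y ^ N ≡ sgn m → finv α β θ s m y ≡ u α s y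
  finv≡u α β θ s m {y} y^N≡sgn = begin
    finv α β θ s m y                        ≡⟨ finv≡ α β θ s m y ⟩
    (V - U) * (sgn m * y ^ N) - (U + V)     ≡⟨ cong (λ p → (V - U) * p - (U + V))
                                                 (trans (cong (sgn m *_) y^N≡sgn) (sgn*sgn≡1 m)) ⟩
    (V - U) * 1# - (U + V)                  ≡⟨ solve 2 (λ U V → (V :- U) :* con 1ₘ :- (U :+ V) := U) refl U V ⟩
    U                                       ∎
    where U = u α s y
          V = v β θ y

  finv≡v : ∀ α β θ s m {y} → y ^ N ≡ - sgn m → finv α β θ s m y ≡ v β θ y
  finv≡v α β θ s m {y} y^N≡-sgn = begin
    finv α β θ s m y                        ≡⟨ finv≡ α β θ s m y ⟩
    (V - U) * (sgn m * y ^ N) - (U + V)     ≡⟨ cong (λ p → (V - U) * (sgn m * p) - (U + V)) y^N≡-sgn ⟩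
    (V - U) * (sgn m * - sgn m) - (U + V)   ≡⟨ cong (λ p → (V - U) * p - (U + V))
                                                 (trans (solve 1 (λ S → S :* :- S := :- (S :* S)) refl (sgn m))
                                                        (cong -_ (sgn*sgn≡1 m))) ⟩
    (V - U) * - 1# - (U + V)                ≡⟨ solve 2 (λ U V → (V :- U) :* :- con 1ₘ :- (U :+ V) := V) refl U V ⟩
    V                                       ∎
    where U = u α s y
          V = v β θ y

  u[αx^t]≡x : ∀ {α x} t s → α ≢ 0# → x ^ N ≡ 1# → (∃ λ k → s ℕ.* t ≡ 1 ℕ.+ k ℕ.* N) →
              u α s (α * x ^ t) ≡ x
  u[αx^t]≡x {α} {x} t s α≢0 x^N≡1 (k , st≡1+kN) = begin
    (α ⁻¹ * (α * x ^ t)) ^ s   ≡⟨ cong (_^ s) (x⁻¹*[x*y]≡y (x ^ t) α≢0) ⟩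
    (x ^ t) ^ s                ≡⟨ ^-assocʳ x t s ⟩
    x ^ (t ℕ.* s)              ≡⟨ cong (x ^_) (trans (ℕₚ.*-comm t s) st≡1+kN) ⟩
    x * x ^ (k ℕ.* N)          ≡⟨ cong (λ e → x * x ^ e) (ℕₚ.*-comm k N) ⟩
    x * x ^ (N ℕ.* k)          ≡⟨ cong (x *_) (^-assocʳ x N k) ⟨
    x * (x ^ N) ^ k            ≡⟨ cong (λ y → x * y ^ k) x^N≡1 ⟩
    x * 1# ^ k                 ≡⟨ cong (x *_) (1^k≡1 k) ⟩
    x * 1#                     ≡⟨ *-identityʳ x ⟩
    x                          ∎

  v[βx[x-θ]²]≡x : ∀ {β θ x} → β ≢ 0# → θ ≢ 0# → θ ^ N ≡ 1# → x ^ N ≡ - 1# →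
                  v β θ (β * (x * (x - θ) ^ 2)) ≡ x
  v[βx[x-θ]²]≡x {β} {θ} {x} β≢0 θ≢0 θ^N≡1 x^N≡-1 = begin
    v β θ (β * (x * (x - θ) ^ 2))
      ≡⟨ v≡θW·powerSum[W]² β θ _ ⟩
    (θ * W) * (powerSum W * powerSum W)
      ≡⟨ cong (λ w → (θ * w) * (powerSum w * powerSum w)) W≡z[z-1]² ⟩
    (θ * W′) * (powerSum W′ * powerSum W′)
      ≡⟨ solve 3 (λ θ z p → θ :* (z :* (z :- con 1ₘ) :^ 2) :* (p :* p) := θ :* z :* (((z :- con 1ₘ) :* p) :^ 2))
           refl θ z (powerSum W′) ⟩
    θ * z * ((z - 1#) * powerSum W′) ^ 2
      ≡⟨ cong (λ p → θ * z * p ^ 2) [z-1]·powerSum≡1 ⟩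
    θ * z * 1# ^ 2
      ≡⟨ solve 2 (λ θ x → θ :* x :* con 1ₘ :^ 2 := θ :* x) refl θ z ⟩
    θ * (θ ⁻¹ * x)
      ≡⟨ x*[x⁻¹*y]≡y x θ≢0 ⟩
    x ∎
    where
    z  = θ ⁻¹ * x
    W  = β ⁻¹ * (θ ^ 3) ⁻¹ * (β * (x * (x - θ) ^ 2))
    W′ = z * (z - 1#) ^ 2
    θ⁻¹θ≡1 : θ ⁻¹ * θ ≡ 1#
    θ⁻¹θ≡1 = trans (*-comm (θ ⁻¹) θ) (inverseʳ θ θ≢0)
    [θ³]⁻¹≡[θ⁻¹]³ : (θ ^ 3) ⁻¹ ≡ (θ ⁻¹) ^ 3
    [θ³]⁻¹≡[θ⁻¹]³ = ⁻¹-unique (^-nonzero 3 θ≢0)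
      (trans (sym (^-distrib-* θ (θ ⁻¹) 3)) (trans (cong (_^ 3) (inverseʳ θ θ≢0)) (1^k≡1 3)))
    W≡z[z-1]² : W ≡ W′
    W≡z[z-1]² = begin
      β ⁻¹ * (θ ^ 3) ⁻¹ * (β * (x * (x - θ) ^ 2))
        ≡⟨ cong (λ i → β ⁻¹ * i * (β * (x * (x - θ) ^ 2))) [θ³]⁻¹≡[θ⁻¹]³ ⟩
      β ⁻¹ * θ ⁻¹ ^ 3 * (β * (x * (x - θ) ^ 2))
        ≡⟨ solve 5 (λ b′ b i θ x → b′ :* i :^ 3 :* (b :* (x :* (x :- θ) :^ 2))
                     := (b′ :* b) :* ((i :* x) :* (i :* x :- i :* θ) :^ 2)) refl (β ⁻¹) β (θ ⁻¹) θ x ⟩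
      (β ⁻¹ * β) * (z * (z - θ ⁻¹ * θ) ^ 2)
        ≡⟨ cong₂ (λ a c → a * (z * (z - c) ^ 2)) (trans (*-comm (β ⁻¹) β) (inverseʳ β β≢0)) θ⁻¹θ≡1 ⟩
      1# * W′   ≡⟨ *-identityˡ W′ ⟩
      W′        ∎
    z^N≡-1 : z ^ N ≡ - 1#
    z^N≡-1 = begin
      (θ ⁻¹ * x) ^ N
        ≡⟨ ^-distrib-* (θ ⁻¹) x N ⟩
      θ ⁻¹ ^ N * x ^ N
        ≡⟨ cong₂ _*_ (trans (sym (*-identityʳ _)) (cong (θ ⁻¹ ^ N *_) (sym θ^N≡1))) x^N≡-1 ⟩
      θ ⁻¹ ^ N * θ ^ N * - 1#
        ≡⟨ cong (_* - 1#) (trans (sym (^-distrib-* (θ ⁻¹) θ N)) (cong (_^ N) θ⁻¹θ≡1)) ⟩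
      1# ^ N * - 1#
        ≡⟨ trans (cong (_* - 1#) (1^k≡1 N)) (*-identityˡ (- 1#)) ⟩
      - 1# ∎
    [z-1]·powerSum≡1 : (z - 1#) * powerSum W′ ≡ 1#
    [z-1]·powerSum≡1 = begin
      (z - 1#) * powerSum W′   ≡⟨ powerSum-telescopes z ⟩
      z ^ N - 1#               ≡⟨ cong (_- 1#) z^N≡-1 ⟩
      - 1# - 1#                ≡⟨ solve 0 (:- con 1ₘ :- con 1ₘ := con 1ₘ) refl ⟩
      1#                       ∎

  module _ (t : ℕ) (α β θ : Carrier) (α≢0 : α ≢ 0#) (β≢0 : β ≢ 0#) (θ≢0 : θ ≢ 0#)
           (f : Carrier → Carrier) (f0≡0 : f 0# ≡ 0#)
           (f-C₀ : ∀ x → C₀ x → f x ≡ α * x ^ t)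
           (f-C₁ : ∀ x → C₁ x → f x ≡ β * (x ^ 3 + θ * x ^ 2 + θ ^ 2 * x))
           (f-bijective : Bijective _≡_ _≡_ f)
           (m : ℕ) (η[α]≡[-1]^m : η≡[-1]^ α m)
           (s : ℕ) (s-inverse : ∃ λ k → s ℕ.* t ≡ 1 ℕ.+ k ℕ.* N) where

    f-C₁′ : ∀ x → C₁ x → f x ≡ β * (x * (x - θ) ^ 2)
    f-C₁′ x x∈C₁ = trans (f-C₁ x x∈C₁) (cong (β *_)
      (solve 2 (λ x θ → x :^ 3 :+ θ :* x :^ 2 :+ θ :^ 2 :* x := x :* (x :- θ) :^ 2) refl x θ))

    θ∈C₀ : C₀ θ
    θ∈C₀ with C₀? θ
    ... | yes θ∈C₀ = θ∈C₀
    ... | no θ∉C₀  = contradiction (proj₁ f-bijective (trans fθ≡0 (sym f0≡0))) θ≢0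
      where
      fθ≡0 : f θ ≡ 0#
      fθ≡0 = begin
        f θ                          ≡⟨ f-C₁′ θ (θ≢0 , θ∉C₀) ⟩
        β * (θ * (θ - θ) ^ 2)        ≡⟨ cong (λ d → β * (θ * d ^ 2)) (-‿inverseʳ θ) ⟩
        β * (θ * 0# ^ 2)             ≡⟨ solve 2 (λ b θ → b :* (θ :* con 0ₘ :^ 2) := con 0ₘ) refl β θ ⟩
        0#                           ∎

    α^N≡sgn : α ^ N ≡ sgn m
    α^N≡sgn = from-η η[α]≡[-1]^m
      where
      from-η : η≡[-1]^ α m → α ^ N ≡ sgn m
      from-η (inj₁ (m≡0 , α∈C₀)) = trans (C₀⇒^N≡1 α∈C₀) (cong sgn (sym m≡0))
      from-η (inj₂ (m≡1 , α∈C₁)) =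
        trans (C₁⇒^N≡-1 α∈C₁) (trans (sym (*-identityʳ (- 1#))) (cong sgn (sym m≡1)))

    f[C₀]^N≡sgn : ∀ x → C₀ x → f x ^ N ≡ sgn m
    f[C₀]^N≡sgn x x∈C₀ = begin
      f x ^ N                  ≡⟨ cong (_^ N) (f-C₀ x x∈C₀) ⟩
      (α * x ^ t) ^ N          ≡⟨ ^-distrib-* α (x ^ t) N ⟩
      α ^ N * (x ^ t) ^ N      ≡⟨ cong (α ^ N *_) (trans (^-assocʳ x t N)
                                    (trans (cong (x ^_) (ℕₚ.*-comm t N)) (sym (^-assocʳ x N t)))) ⟩
      α ^ N * (x ^ N) ^ t      ≡⟨ cong (λ y → α ^ N * y ^ t) (C₀⇒^N≡1 x∈C₀) ⟩
      α ^ N * 1# ^ t           ≡⟨ trans (cong (α ^ N *_) (1^k≡1 t)) (*-identityʳ (α ^ N)) ⟩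
      α ^ N                    ≡⟨ α^N≡sgn ⟩
      sgn m                    ∎

    f[C₁]^N≡-β^N : ∀ x → C₁ x → f x ^ N ≡ - (β ^ N)
    f[C₁]^N≡-β^N x x∈C₁ = begin
      f x ^ N
        ≡⟨ cong (_^ N) (f-C₁′ x x∈C₁) ⟩
      (β * (x * (x - θ) ^ 2)) ^ N
        ≡⟨ trans (^-distrib-* β _ N) (cong (β ^ N *_) (^-distrib-* x _ N)) ⟩
      β ^ N * (x ^ N * ((x - θ) ^ 2) ^ N)
        ≡⟨ cong₂ (λ a b → β ^ N * (a * b)) (C₁⇒^N≡-1 x∈C₁) (C₀⇒^N≡1 [x-θ]²∈C₀) ⟩
      β ^ N * (- 1# * 1#)
        ≡⟨ solve 1 (λ b → b :* (:- con 1ₘ :* con 1ₘ) := :- b) refl (β ^ N) ⟩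
      - (β ^ N) ∎
      where
      x-θ≢0 : x - θ ≢ 0#
      x-θ≢0 x-θ≡0 = proj₂ x∈C₁ (subst C₀ (sym (x∙y⁻¹≈ε⇒x≈y x θ x-θ≡0)) θ∈C₀)
      [x-θ]²∈C₀ : C₀ ((x - θ) ^ 2)
      [x-θ]²∈C₀ = x - θ , x-θ≢0 , cong ((x - θ) *_) (sym (*-identityʳ (x - θ)))

    -- y₀ = x₀ if α is a square and y₀ = 1 otherwise; its preimage under f must be a non-square.
    β^N≡α^N : ∀ {x₀} → C₁ x₀ → β ^ N ≡ α ^ N
    β^N≡α^N {x₀} x₀∈C₁ = -‿injective (trans (sym (f[C₁]^N≡-β^N w w∈C₁)) fw^N≡-α^N)
      where
      choose-y₀ : η≡[-1]^ α m → ∃ λ y → y ≢ 0# × y ^ N ≡ - (α ^ N)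
      choose-y₀ (inj₁ (_ , α∈C₀)) = x₀ , proj₁ x₀∈C₁
        , trans (C₁⇒^N≡-1 x₀∈C₁) (cong -_ (sym (C₀⇒^N≡1 α∈C₀)))
      choose-y₀ (inj₂ (_ , α∈C₁)) = 1# , 0≢1 ∘ sym
        , trans (1^k≡1 N) (trans (sym (-‿involutive 1#)) (cong -_ (sym (C₁⇒^N≡-1 α∈C₁))))
      y₀ : ∃ λ y → y ≢ 0# × y ^ N ≡ - (α ^ N)
      y₀ = choose-y₀ η[α]≡[-1]^m
      w : Carrier
      w = proj₁ (proj₂ f-bijective (proj₁ y₀))
      fw≡y₀ : f w ≡ proj₁ y₀
      fw≡y₀ = proj₂ (proj₂ f-bijective (proj₁ y₀)) refl
      fw^N≡-α^N : f w ^ N ≡ - (α ^ N)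
      fw^N≡-α^N = trans (cong (_^ N) fw≡y₀) (proj₂ (proj₂ y₀))
      w∈C₁ : C₁ w
      w∈C₁ = (λ w≡0 → proj₁ (proj₂ y₀) (trans (sym fw≡y₀) (trans (cong f w≡0) f0≡0)))
           , (λ w∈C₀ → x≢-x (^-nonzero N α≢0)
                          (trans α^N≡sgn (trans (sym (f[C₀]^N≡sgn w w∈C₀)) fw^N≡-α^N)))

    finv[f0]≡0 : finv α β θ s m (f 0#) ≡ 0#
    finv[f0]≡0 = begin
      finv α β θ s m (f 0#)              ≡⟨ cong (finv α β θ s m) f0≡0 ⟩
      finv α β θ s m 0#                  ≡⟨ cong₂ (λ a b → - (a * p) - b * q) u[0]≡0 v[0]≡0 ⟩
      - (0# * p) - 0# * q                ≡⟨ solve 2 (λ p q → :- (con 0ₘ :* p) :- con 0ₘ :* q := con 0ₘ)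
                                              refl p q ⟩
      0#                                 ∎
      where
      p = 1# + sgn m * 0# ^ N
      q = 1# + sgn (suc m) * 0# ^ N
      0^r≡0 : ∀ r → r ℕ.* t ≡ 1 ℕ.+ proj₁ s-inverse ℕ.* N → 0# ^ r ≡ 0#
      0^r≡0 (suc r) _ = zeroˡ _
      u[0]≡0 : u α s 0# ≡ 0#
      u[0]≡0 = trans (cong (_^ s) (zeroʳ (α ⁻¹))) (0^r≡0 s (proj₂ s-inverse))
      W₀ = β ⁻¹ * (θ ^ 3) ⁻¹ * 0#
      v[0]≡0 : v β θ 0# ≡ 0#
      v[0]≡0 = begin
        v β θ 0#
          ≡⟨ v≡θW·powerSum[W]² β θ 0# ⟩
        (θ * W₀) * (powerSum W₀ * powerSum W₀)
          ≡⟨ cong (λ w → (θ * w) * (powerSum w * powerSum w)) (zeroʳ _) ⟩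
        (θ * 0#) * (powerSum 0# * powerSum 0#)
          ≡⟨ solve 2 (λ θ p → θ :* con 0ₘ :* p := con 0ₘ) refl θ _ ⟩
        0# ∎

    finv∘f≡id-on-C₀ : ∀ x → C₀ x → finv α β θ s m (f x) ≡ x
    finv∘f≡id-on-C₀ x x∈C₀ = begin
      finv α β θ s m (f x)    ≡⟨ finv≡u α β θ s m (f[C₀]^N≡sgn x x∈C₀) ⟩
      u α s (f x)             ≡⟨ cong (u α s) (f-C₀ x x∈C₀) ⟩
      u α s (α * x ^ t)       ≡⟨ u[αx^t]≡x t s α≢0 (C₀⇒^N≡1 x∈C₀) s-inverse ⟩
      x                       ∎

    finv∘f≡id-on-C₁ : ∀ x → C₁ x → finv α β θ s m (f x) ≡ x
    finv∘f≡id-on-C₁ x x∈C₁ = begin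
      finv α β θ s m (f x)            ≡⟨ finv≡v α β θ s m f[x]^N≡-sgn ⟩
      v β θ (f x)                     ≡⟨ cong (v β θ) (f-C₁′ x x∈C₁) ⟩
      v β θ (β * (x * (x - θ) ^ 2))   ≡⟨ v[βx[x-θ]²]≡x β≢0 θ≢0 (C₀⇒^N≡1 θ∈C₀) (C₁⇒^N≡-1 x∈C₁) ⟩
      x                               ∎
      where
      f[x]^N≡-sgn : f x ^ N ≡ - sgn m
      f[x]^N≡-sgn = trans (f[C₁]^N≡-β^N x x∈C₁) (cong -_ (trans (β^N≡α^N x∈C₁) α^N≡sgn))

    finv∘f≡id : ∀ x → finv α β θ s m (f x) ≡ x
    finv∘f≡id x with x ≟ 0# | C₀? x
    ... | yes refl | _        = finv[f0]≡0
    ... | no _     | yes x∈C₀ = finv∘f≡id-on-C₀ x x∈C₀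
    ... | no x≢0   | no x∉C₀  = finv∘f≡id-on-C₁ x (x≢0 , x∉C₀)

theorem8 : (n t : ℕ) → n ≥ 1 → t ≥ 1 → (F : GF3 n) →
    let open GF3 F in
    (α β θ : Carrier) → α ≢ 0# → β ≢ 0# → θ ≢ 0# →
    (f : Carrier → Carrier) →
    f 0# ≡ 0# →
    (∀ x → C₀ x → f x ≡ α * x ^ t) →
    (∀ x → C₁ x → f x ≡ β * (x ^ 3 + θ * x ^ 2 + θ ^ 2 * x)) →
    Bijective _≡_ _≡_ f →
    (m : ℕ) → η≡[-1]^ α m →
    (s : ℕ) → (∃ λ k → s ℕ.* t ≡ 1 ℕ.+ k ℕ.* N) →
    ∀ x → finv α β θ s m (f x) ≡ x
theorem8 n t _ _ F = InverseFormula.finv∘f≡id F t
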